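{- The set $\mathrm{Modasc}$ of modified ascent sequences equals the set of Cayley permutations that avoid both mesh patterns $\mathfrak a$ and $\mathfrak b$. Consequently, for every $n$, the number of Cayley permutations of length $n$ avoiding $\mathfrak a$ and $\mathfrak b$ equals the number of Fishburn permutations of length $n$ (i.e., $\{\mathfrak a,\mathfrak b\}$ is Wilf-equivalent over Cayley permutations to $\{11,\text{the Fishburn pattern}\}$).
   Context: A Cayley permutation of length $n\ge0$ is a word $x=x(1)\cdots x(n)$ of positive integers in which every integer from $1$ to $\max(x)$ occurs. A Cayley permutation $x$ contains the mesh pattern $\mathfrak a$ if there are indices $i<j<n$ with $x(j)<x(i)=x(j+1)$; it contains $\mathfrak b$ if there is an index $i<n$ with $x(i)>x(i+1)$ such that the value $x(i+1)$ does not occur among $x(1),\dots,x(i-1)$; it avoids a pattern if it does not contain it. Modified ascent sequences: the empty word and $1$ are modified ascent sequences; for $n\ge2$, a word $x$ of length $n$ is one iff either $x=va$ with $v$ a modified ascent sequence of length $n-1$ with last letter $b$ and $1\le a\le b$, or $x=\tilde va$ with $v$ as before, $b<a\le 2+\mathrm{asc}(v)$, where $\mathrm{asc}(v)=|\{i:v(i)<v(i+1)\}|$ and $\tilde v$ is obtained from $v$ by increasing every entry $c\ge a$ by one. A permutation $\pi$ is Fishburn if there are no indices $i$ and $k>i+1$ with $\pi(k)<\pi(i)<\pi(i+1)$ and $\pi(i)=\pi(k)+1$. It is known (Bousquet-Mélou et al.) that modified ascent sequences and Fishburn permutations of each length are equinumerous. -}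

module Defs where

open import Data.Nat using (ℕ; zero; suc; _+_; _≤_; _<_; _⊔_; _≤ᵇ_)
open import Data.Bool using (if_then_else_)
open import Data.List using (List; []; _∷_; _++_; [_]; map; length; foldr; last; upTo)
open import Data.List.Membership.Propositional using (_∈_)
open import Data.List.Relation.Unary.All using (All)
open import Data.List.Relation.Unary.Unique.Propositional using (Unique)
open import Data.List.Relation.Binary.Permutation.Propositional using (_↭_)
open import Data.Maybe using (just)
open import Data.Product using (Σ; _×_; ∃-syntax)
open import Relation.Binary.PropositionalEquality using (_≡_; _≢_)
open import Relation.Nullary using (¬_)
open import Function.Bundles using (_⇔_)

-- Words are lists of naturals. Indexing is 0-based: x ! i is the (i+1)-st
-- letter of x (default 0 when out of range; all uses below carry explicit
-- range hypotheses).
_!_ : List ℕ → ℕ → ℕ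
[]       ! _     = 0
(a ∷ _)  ! zero  = a
(_ ∷ xs) ! suc i = xs ! i

maxL : List ℕ → ℕ
maxL = foldr _⊔_ 0

Cayley : List ℕ → Set
Cayley x = All (1 ≤_) x × (∀ k → 1 ≤ k → k ≤ maxL x → k ∈ x)

-- Mesh pattern a: indices i<j<n (1-based) with x(j) < x(i) = x(j+1).
-- 0-based: i < j, j+1 < length x.
ContainsA : List ℕ → Set
ContainsA x = ∃[ i ] ∃[ j ] (i < j × suc j < length x ×
                x ! j < x ! i × x ! i ≡ x ! suc j)

ContainsB : List ℕ → Set
ContainsB x = ∃[ i ] (suc i < length x × x ! suc i < x ! i ×
                (∀ k → k < i → x ! k ≢ x ! suc i))

asc : List ℕ → ℕ
asc []           = 0
asc (a ∷ [])     = 0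
asc (a ∷ b ∷ xs) = (if suc a ≤ᵇ b then 1 else 0) + asc (b ∷ xs)

bump : ℕ → ℕ → ℕ
bump a c = if a ≤ᵇ c then suc c else c

data ModAsc : List ℕ → Set where
  empty : ModAsc []
  one   : ModAsc [ 1 ]
  keep  : ∀ {v b a} → ModAsc v → last v ≡ just b → 1 ≤ a → a ≤ b →
          ModAsc (v ++ [ a ])
  raise : ∀ {v b a} → ModAsc v → last v ≡ just b → b < a → a ≤ 2 + asc v →
          ModAsc (map (bump a) v ++ [ a ])

IsPerm : ℕ → List ℕ → Set
IsPerm n π = π ↭ map suc (upTo n)

Fishburn : List ℕ → Set
Fishburn π = ¬ (∃[ i ] ∃[ k ] (suc i < k × k < length π ×
                 π ! k < π ! i × π ! i < π ! suc i × π ! i ≡ suc (π ! k)))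

CayleyAB : List ℕ → Set
CayleyAB x = Cayley x × ¬ ContainsA x × ¬ ContainsB x

Enumerates : (List ℕ → Set) → List (List ℕ) → Set
Enumerates P L = Unique L × (∀ x → (x ∈ L) ⇔ P x)

-- Let x = u b a be a Cayley permutation. An occurrence of 𝔞 that is not already in u b must end
-- at a, which happens iff b < a and a occurs in u; likewise a new occurrence of 𝔟 exists iff a < b
-- and a does not occur in u. So for an avoider either a ≤ b and a occurs in u b (a keep step of
-- ModAsc), or b < a and a does not occur in u b, and lowering the letters above a gives a shorter
-- avoider (a raise step). Along ModAsc the maximum is always 1 + asc, which matches the bound
-- a ≤ 2 + asc of the raise step; by induction on the length the two sets coincide.
--
-- For the count, modified ascent sequences are generated by appending a last letter, x having
-- 2 + asc x children, and Fishburn permutations by inserting a new maximum at an active site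
-- (one where no Fishburn pattern is created). Keeping x leaves asc unchanged and raising increases
-- it by one; inserting the maximum left of the old maximum leaves the number of active sites
-- unchanged, inserting it to the right adds one. Matching the a-th child with the a-th active site
-- makes the two generating trees isomorphic, so their levels have the same size.

module Submission where

open import Defs
open import Data.Bool using (Bool; true; false; not; _∧_; _∨_; if_then_else_)
open import Data.Bool.Properties using (∧-assoc; ∧-identityʳ; ∧-zeroʳ; ∨-zeroʳ; ∧-conicalˡ; ∧-conicalʳ; ∨-conicalʳ)
open import Data.Empty using (⊥-elim)
open import Data.List
  using (List; []; _∷_; _++_; [_]; _∷ʳ_; map; length; last; concatMap; upTo; take; drop; initLast; _∷ʳ′_)
open import Data.List.Properties
  using ( length-++; length-++-≤ˡ; length-map; map-id; map-++; map-injective; map-upTo; upTo-∷ʳ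
        ; last-map; ∷-injective; ∷ʳ-injective; ++-identityʳ; take++drop≡id)
open import Data.List.Membership.Propositional using (_∈_; _∉_; find; lose)
open import Data.List.Membership.Propositional.Properties
  using ( ∈-map⁺; ∈-map⁻; ∈-++⁺ˡ; ∈-++⁺ʳ; ∈-++⁻; ∈-upTo⁺; ∈-upTo⁻; ∈-∃++
        ; ∈-concatMap⁺; ∈-concatMap⁻)
open import Data.List.Relation.Unary.Any using (here; there)
open import Data.List.Relation.Unary.All as All using (All; []; _∷_)
import Data.List.Relation.Unary.All.Properties as All
open import Data.List.Relation.Unary.AllPairs using ([]; _∷_)
open import Data.List.Relation.Unary.Unique.Propositional using (Unique)
import Data.List.Relation.Unary.Unique.Propositional.Properties as Unique
open import Data.List.Relation.Binary.Pointwise as Pointwise using (Pointwise; []; _∷_; Pointwise-length)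
open import Data.List.Relation.Binary.Permutation.Propositional
  using (_↭_; ↭-sym; ↭-trans; ↭-reflexive; prep; module PermutationReasoning)
open import Data.List.Relation.Binary.Permutation.Propositional.Properties
  using (shift; drop-mid; ∈-resp-↭; ∷↭∷ʳ; ↭-empty-inv)
open import Data.Maybe using (just; nothing; fromMaybe)
import Data.Maybe as Maybe
open import Data.Nat
  using (ℕ; zero; suc; pred; _+_; _≤_; _<_; _≤ᵇ_; z≤n; s≤s; _≟_; _≤?_; _<?_; >-nonZero)
open import Data.List.Membership.DecPropositional _≟_ using (_∈?_)
open import Data.Nat.Properties
open import Data.Product using (_×_; _,_; proj₁; proj₂; ∃-syntax)
open import Data.Sum using (_⊎_; inj₁; inj₂) renaming ([_,_] to either)
open import Function using (_∘_; id; case_of_)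
open import Function.Bundles using (_⇔_; mk⇔; Equivalence)
open import Relation.Binary.Core using (_Preserves_⟶_)
open import Relation.Binary.Definitions using (tri<; tri≈; tri>)
open import Relation.Binary.PropositionalEquality
  using (_≡_; _≢_; refl; sym; trans; cong; cong₂; subst; subst₂; module ≡-Reasoning)
open import Relation.Nullary using (¬_; yes; no; does)
open import Relation.Nullary.Decidable using (dec-true; dec-false; does-⇔)

≤ᵇ-true : ∀ {m n} → m ≤ n → (m ≤ᵇ n) ≡ true
≤ᵇ-true {m} {n} = dec-true (m ≤? n)

≤ᵇ-false : ∀ {m n} → n < m → (m ≤ᵇ n) ≡ false
≤ᵇ-false {m} {n} n<m = dec-false (m ≤? n) (<⇒≱ n<m)

length-∷ʳ : ∀ {A : Set} (v : List A) a → length (v ∷ʳ a) ≡ suc (length v)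
length-∷ʳ v a = trans (length-++ v) (+-comm (length v) 1)

last-∷ʳ : ∀ {A : Set} (v : List A) a → last (v ∷ʳ a) ≡ just a
last-∷ʳ []          a = refl
last-∷ʳ (_ ∷ [])    a = refl
last-∷ʳ (_ ∷ c ∷ v) a = last-∷ʳ (c ∷ v) a

last⇒∷ʳ : ∀ {A : Set} {v : List A} {b} → last v ≡ just b → ∃[ u ] v ≡ u ∷ʳ b
last⇒∷ʳ {v = c ∷ []}    refl = [] , refl
last⇒∷ʳ {v = c ∷ d ∷ v} eq  with last⇒∷ʳ {v = d ∷ v} eq
... | u , e = c ∷ u , cong (c ∷_) e

last⇒∈ : ∀ {A : Set} {v : List A} {b} → last v ≡ just b → b ∈ v
last⇒∈ {v = v} eq with last⇒∷ʳ {v = v} eq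
... | u , refl = ∈-++⁺ʳ u (here refl)

!-++ˡ : ∀ v {w i} → i < length v → (v ++ w) ! i ≡ v ! i
!-++ˡ (c ∷ v) {i = zero}  _        = refl
!-++ˡ (c ∷ v) {i = suc i} (s≤s i<) = !-++ˡ v i<

!-∷ʳ : ∀ v {a} → (v ∷ʳ a) ! length v ≡ a
!-∷ʳ []      = refl
!-∷ʳ (c ∷ v) = !-∷ʳ v

!-map : ∀ f v {i} → i < length v → map f v ! i ≡ f (v ! i)
!-map f (c ∷ v) {zero}  _        = refl
!-map f (c ∷ v) {suc i} (s≤s i<) = !-map f v i<

!-∈ : ∀ v {i} → i < length v → v ! i ∈ v
!-∈ (c ∷ v) {zero}  _        = here refl
!-∈ (c ∷ v) {suc i} (s≤s i<) = there (!-∈ v i<)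

∈⇒! : ∀ {v y} → y ∈ v → ∃[ i ] (i < length v × v ! i ≡ y)
∈⇒! (here refl) = zero , s≤s z≤n , refl
∈⇒! (there y∈)  with ∈⇒! y∈
... | i , i< , eq = suc i , s≤s i< , eq

-- Occurrences of the mesh patterns

ContainsA-++ : ∀ v w → ContainsA v → ContainsA (v ++ w)
ContainsA-++ v w (i , j , i<j , sj< , lt , eq) =
  i , j , i<j , <-≤-trans sj< (length-++-≤ˡ v) ,
  subst₂ _<_ (sym (!-++ˡ v j<)) (sym (!-++ˡ v i<)) lt ,
  trans (!-++ˡ v i<) (trans eq (sym (!-++ˡ v sj<)))
  where
  j< = <-trans (n<1+n j) sj<
  i< = <-trans i<j j<

ContainsB-++ : ∀ v w → ContainsB v → ContainsB (v ++ w)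
ContainsB-++ v w (i , si< , lt , fresh) =
  i , <-≤-trans si< (length-++-≤ˡ v) ,
  subst₂ _<_ (sym (!-++ˡ v si<)) (sym (!-++ˡ v i<)) lt ,
  λ k k<i eq → fresh k k<i (trans (sym (!-++ˡ v (<-trans k<i i<))) (trans eq (!-++ˡ v si<)))
  where
  i< = <-trans (n<1+n i) si<

module LastTwo (u : List ℕ) (b a : ℕ) where

  w : List ℕ
  w = u ∷ʳ b ∷ʳ a

  length-w : length w ≡ suc (suc (length u))
  length-w = trans (length-∷ʳ (u ∷ʳ b) a) (cong suc (length-∷ʳ u b))

  w!u : ∀ {i} → i < length u → w ! i ≡ u ! i
  w!u i< = trans (!-++ˡ (u ∷ʳ b) (<-≤-trans i< (length-++-≤ˡ u))) (!-++ˡ u i<)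

  w!b : w ! length u ≡ b
  w!b = trans (!-++ˡ (u ∷ʳ b) (≤-reflexive (sym (length-∷ʳ u b)))) (!-∷ʳ u)

  w!a : w ! suc (length u) ≡ a
  w!a = trans (cong (w !_) (sym (length-∷ʳ u b))) (!-∷ʳ (u ∷ʳ b))

  w!init : ∀ {i} → i < length (u ∷ʳ b) → w ! i ≡ (u ∷ʳ b) ! i
  w!init = !-++ˡ (u ∷ʳ b)

  split-index : ∀ {j} → suc j < length w → suc j < length (u ∷ʳ b) ⊎ j ≡ length u
  split-index {j} sj< with m≤n⇒m<n∨m≡n (≤-pred (≤-trans sj< (≤-reflexive length-w)))
  ... | inj₁ sj<su = inj₁ (subst (suc j <_) (sym (length-∷ʳ u b)) sj<su)
  ... | inj₂ eq    = inj₂ (suc-injective eq)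

ContainsA-∷ʳ⇔ : ∀ u b a → ContainsA (u ∷ʳ b ∷ʳ a) ⇔ (ContainsA (u ∷ʳ b) ⊎ (b < a × a ∈ u))
ContainsA-∷ʳ⇔ u b a = mk⇔ split join
  where
  open LastTwo u b a
  split : ContainsA w → ContainsA (u ∷ʳ b) ⊎ (b < a × a ∈ u)
  split (i , j , i<j , sj< , lt , eq) with split-index sj<
  ... | inj₁ sj<v = inj₁ (i , j , i<j , sj<v ,
                          subst₂ _<_ (w!init j<) (w!init i<) lt ,
                          trans (sym (w!init i<)) (trans eq (w!init sj<v)))
    where
    j< = <-trans (n<1+n j) sj<v
    i< = <-trans i<j j<
  ... | inj₂ refl = inj₂ (subst₂ _<_ w!b (trans eq w!a) lt ,
                          subst (_∈ u) (trans (sym (w!u i<j)) (trans eq w!a)) (!-∈ u i<j))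
  join : ContainsA (u ∷ʳ b) ⊎ (b < a × a ∈ u) → ContainsA w
  join (inj₁ A) = ContainsA-++ (u ∷ʳ b) [ a ] A
  join (inj₂ (b<a , a∈u)) with ∈⇒! a∈u
  ... | i , i< , ui≡a = i , length u , i< , ≤-reflexive (sym length-w) ,
                        subst₂ _<_ (sym w!b) (sym (trans (w!u i<) ui≡a)) b<a ,
                        trans (w!u i<) (trans ui≡a (sym w!a))

ContainsB-∷ʳ⇔ : ∀ u b a → ContainsB (u ∷ʳ b ∷ʳ a) ⇔ (ContainsB (u ∷ʳ b) ⊎ (a < b × a ∉ u))
ContainsB-∷ʳ⇔ u b a = mk⇔ split join
  where
  open LastTwo u b a
  split : ContainsB w → ContainsB (u ∷ʳ b) ⊎ (a < b × a ∉ u)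
  split (i , si< , lt , fresh) with split-index si<
  ... | inj₁ si<v = inj₁ (i , si<v ,
                          subst₂ _<_ (w!init si<v) (w!init i<) lt ,
                          λ k k<i eq → fresh k k<i (trans (w!init (<-trans k<i i<)) (trans eq (sym (w!init si<v)))))
    where
    i< = <-trans (n<1+n i) si<v
  ... | inj₂ refl = inj₂ (subst₂ _<_ w!a w!b lt , a∉u)
    where
    a∉u : a ∉ u
    a∉u a∈u with ∈⇒! a∈u
    ... | k , k< , uk≡a = fresh k k< (trans (w!u k<) (trans uk≡a (sym w!a)))
  join : ContainsB (u ∷ʳ b) ⊎ (a < b × a ∉ u) → ContainsB w
  join (inj₁ B) = ContainsB-++ (u ∷ʳ b) [ a ] B
  join (inj₂ (a<b , a∉u)) =
    length u , ≤-reflexive (sym length-w) , subst₂ _<_ (sym w!a) (sym w!b) a<b ,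
    λ k k< eq → a∉u (subst (_∈ u) (trans (sym (w!u k<)) (trans eq w!a)) (!-∈ u k<))

ascentBit : ℕ → ℕ → ℕ
ascentBit b a = if suc b ≤ᵇ a then 1 else 0

module _ {f : ℕ → ℕ} (f-mono : f Preserves _<_ ⟶ _<_) where

  mono-reflects-< : ∀ {x y} → f x < f y → x < y
  mono-reflects-< {x} {y} fx<fy with <-cmp x y
  ... | tri< x<y _ _    = x<y
  ... | tri≈ _ refl _   = ⊥-elim (<-irrefl refl fx<fy)
  ... | tri> _ _ y<x    = ⊥-elim (<-asym fx<fy (f-mono y<x))

  mono-injective : ∀ {x y} → f x ≡ f y → x ≡ y
  mono-injective {x} {y} fx≡fy with <-cmp x y
  ... | tri< x<y _ _ = ⊥-elim (<⇒≢ (f-mono x<y) fx≡fy)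
  ... | tri≈ _ x≡y _ = x≡y
  ... | tri> _ _ y<x = ⊥-elim (<⇒≢ (f-mono y<x) (sym fx≡fy))

  ContainsA-map⇔ : ∀ v → ContainsA (map f v) ⇔ ContainsA v
  ContainsA-map⇔ v = mk⇔ reflect preserve
    where
    length≡ = length-map f v
    reflect : ContainsA (map f v) → ContainsA v
    reflect (i , j , i<j , sj< , lt , eq) =
      i , j , i<j , sj<v ,
      mono-reflects-< (subst₂ _<_ (!-map f v j<) (!-map f v i<) lt) ,
      mono-injective (trans (sym (!-map f v i<)) (trans eq (!-map f v sj<v)))
      where
      sj<v = subst (suc j <_) length≡ sj<
      j<   = <-trans (n<1+n j) sj<v
      i<   = <-trans i<j j<
    preserve : ContainsA v → ContainsA (map f v)
    preserve (i , j , i<j , sj< , lt , eq) =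
      i , j , i<j , subst (suc j <_) (sym length≡) sj< ,
      subst₂ _<_ (sym (!-map f v j<)) (sym (!-map f v i<)) (f-mono lt) ,
      trans (!-map f v i<) (trans (cong f eq) (sym (!-map f v sj<)))
      where
      j< = <-trans (n<1+n j) sj<
      i< = <-trans i<j j<

  ContainsB-map⇔ : ∀ v → ContainsB (map f v) ⇔ ContainsB v
  ContainsB-map⇔ v = mk⇔ reflect preserve
    where
    length≡ = length-map f v
    reflect : ContainsB (map f v) → ContainsB v
    reflect (i , si< , lt , fresh) =
      i , si<v , mono-reflects-< (subst₂ _<_ (!-map f v si<v) (!-map f v i<) lt) ,
      λ k k<i eq → fresh k k<i (trans (!-map f v (<-trans k<i i<)) (trans (cong f eq) (sym (!-map f v si<v))))
      where
      si<v = subst (suc i <_) length≡ si<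
      i<   = <-trans (n<1+n i) si<v
    preserve : ContainsB v → ContainsB (map f v)
    preserve (i , si< , lt , fresh) =
      i , subst (suc i <_) (sym length≡) si< ,
      subst₂ _<_ (sym (!-map f v si<)) (sym (!-map f v i<)) (f-mono lt) ,
      λ k k<i eq → fresh k k<i (mono-injective (trans (sym (!-map f v (<-trans k<i i<))) (trans eq (!-map f v si<))))
      where
      i< = <-trans (n<1+n i) si<

  asc-map : ∀ v → asc (map f v) ≡ asc v
  asc-map []          = refl
  asc-map (c ∷ [])    = refl
  asc-map (c ∷ d ∷ v) =
    cong₂ _+_ (cong (λ t → if t then 1 else 0) (does-⇔ (mk⇔ mono-reflects-< f-mono) (f c <? f d) (c <? d)))
              (asc-map (d ∷ v))

bump-< : ∀ {a c} → c < a → bump a c ≡ c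
bump-< c<a rewrite ≤ᵇ-false c<a = refl

bump-≥ : ∀ {a c} → a ≤ c → bump a c ≡ suc c
bump-≥ a≤c rewrite ≤ᵇ-true a≤c = refl

bump-mono : ∀ a → bump a Preserves _<_ ⟶ _<_
bump-mono a {x} {y} x<y with a ≤? x | a ≤? y
... | yes a≤x | yes a≤y rewrite bump-≥ a≤x | bump-≥ a≤y = s≤s x<y
... | yes a≤x | no  a≰y = ⊥-elim (a≰y (≤-trans a≤x (<⇒≤ x<y)))
... | no  a≰x | yes a≤y rewrite bump-< (≰⇒> a≰x) | bump-≥ a≤y = m≤n⇒m≤1+n x<y
... | no  a≰x | no  a≰y rewrite bump-< (≰⇒> a≰x) | bump-< (≰⇒> a≰y) = x<y

bump≢ : ∀ a c → bump a c ≢ a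
bump≢ a c with a ≤? c
... | yes a≤c rewrite bump-≥ a≤c = λ eq → <⇒≢ (s≤s a≤c) (sym eq)
... | no  a≰c rewrite bump-< (≰⇒> a≰c) = <⇒≢ (≰⇒> a≰c)

unbump : ℕ → ℕ → ℕ
unbump a c = if a ≤ᵇ c then pred c else c

unbump-< : ∀ {a c} → c < a → unbump a c ≡ c
unbump-< c<a rewrite ≤ᵇ-false c<a = refl

unbump-≥ : ∀ {a c} → a ≤ c → unbump a c ≡ pred c
unbump-≥ a≤c rewrite ≤ᵇ-true a≤c = refl

bump-unbump : ∀ a c → c ≢ a → bump a (unbump a c) ≡ c
bump-unbump a c c≢a with <-cmp c a
... | tri< c<a _ _ rewrite unbump-< c<a = bump-< c<a
... | tri≈ _ c≡a _ = ⊥-elim (c≢a c≡a)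
... | tri> _ _ (s≤s a≤c′) rewrite unbump-≥ (m≤n⇒m≤1+n a≤c′) = bump-≥ a≤c′

map-bump-unbump : ∀ a v → a ∉ v → map (bump a) (map (unbump a) v) ≡ v
map-bump-unbump a []      _   = refl
map-bump-unbump a (c ∷ v) a∉ =
  cong₂ _∷_ (bump-unbump a c (λ c≡a → a∉ (here (sym c≡a)))) (map-bump-unbump a v (a∉ ∘ there))

map-bump-∷ʳ : ∀ {a b} u → b < a → map (bump a) (u ∷ʳ b) ≡ map (bump a) u ∷ʳ b
map-bump-∷ʳ {a} u b<a = trans (map-++ (bump a) u _) (cong (λ t → map (bump a) u ∷ʳ t) (bump-< b<a))

ascentBit-≤ : ∀ {b a} → a ≤ b → ascentBit b a ≡ 0
ascentBit-≤ a≤b rewrite ≤ᵇ-false (s≤s a≤b) = refl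

ascentBit-< : ∀ {b a} → b < a → ascentBit b a ≡ 1
ascentBit-< b<a rewrite ≤ᵇ-true b<a = refl

asc-∷ʳ : ∀ u b a → asc (u ∷ʳ b ∷ʳ a) ≡ asc (u ∷ʳ b) + ascentBit b a
asc-∷ʳ []          b a = +-identityʳ _
asc-∷ʳ (c ∷ [])    b a =
  trans (cong (ascentBit c b +_) (+-identityʳ _)) (cong (_+ ascentBit b a) (sym (+-identityʳ _)))
asc-∷ʳ (c ∷ d ∷ u) b a =
  trans (cong (ascentBit c d +_) (asc-∷ʳ (d ∷ u) b a)) (sym (+-assoc (ascentBit c d) _ _))

asc-keep : ∀ v {b a} → last v ≡ just b → a ≤ b → asc (v ∷ʳ a) ≡ asc v
asc-keep v {b} {a} lv a≤b with last⇒∷ʳ {v = v} lv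
... | u , refl = trans (asc-∷ʳ u b a) (trans (cong (asc (u ∷ʳ b) +_) (ascentBit-≤ a≤b)) (+-identityʳ _))

asc-raise : ∀ v {b a} → last v ≡ just b → b < a → asc (map (bump a) v ∷ʳ a) ≡ suc (asc v)
asc-raise v {b} {a} lv b<a with last⇒∷ʳ {v = v} lv
... | u , refl = begin
  asc (map (bump a) (u ∷ʳ b) ∷ʳ a)          ≡⟨ cong (λ t → asc (t ∷ʳ a)) (map-bump-∷ʳ u b<a) ⟩
  asc (map (bump a) u ∷ʳ b ∷ʳ a)            ≡⟨ asc-∷ʳ (map (bump a) u) b a ⟩
  asc (map (bump a) u ∷ʳ b) + ascentBit b a ≡⟨ cong₂ _+_ (cong asc (sym (map-bump-∷ʳ u b<a))) (ascentBit-< b<a) ⟩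
  asc (map (bump a) (u ∷ʳ b)) + 1           ≡⟨ cong (_+ 1) (asc-map (bump-mono a) (u ∷ʳ b)) ⟩
  asc (u ∷ʳ b) + 1                          ≡⟨ +-comm _ 1 ⟩
  suc (asc (u ∷ʳ b))                        ∎
  where open ≡-Reasoning

CayleyWithMax : ℕ → List ℕ → Set
CayleyWithMax m x = All (λ y → 1 ≤ y × y ≤ m) x × (∀ k → 1 ≤ k → k ≤ m → k ∈ x)

∈⇒≤maxL : ∀ {y} x → y ∈ x → y ≤ maxL x
∈⇒≤maxL (z ∷ x) (here refl) = m≤m⊔n z (maxL x)
∈⇒≤maxL (z ∷ x) (there y∈)  = ≤-trans (∈⇒≤maxL x y∈) (m≤n⊔m z (maxL x))

maxL≤ : ∀ {m} x → All (_≤ m) x → maxL x ≤ m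
maxL≤ []      []         = z≤n
maxL≤ (z ∷ x) (z≤ ∷ x≤) = ⊔-lub z≤ (maxL≤ x x≤)

Cayley⇒withMax : ∀ x → Cayley x → CayleyWithMax (maxL x) x
Cayley⇒withMax x (positive , onto) = All.tabulate (λ y∈ → All.lookup positive y∈ , ∈⇒≤maxL x y∈) , onto

withMax⇒Cayley : ∀ {m} x → CayleyWithMax m x → Cayley x
withMax⇒Cayley x (bounds , onto) =
  All.map proj₁ bounds , λ k 1≤k k≤ → onto k 1≤k (≤-trans k≤ (maxL≤ x (All.map proj₂ bounds)))

withMax-unique : ∀ {m m′ x} → CayleyWithMax m x → CayleyWithMax m′ x → m ≡ m′
withMax-unique c c′ = ≤-antisym (max≤ c c′) (max≤ c′ c)
  where
  max≤ : ∀ {m m′ x} → CayleyWithMax m x → CayleyWithMax m′ x → m ≤ m′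
  max≤ {zero}  _           _           = z≤n
  max≤ {suc m} (_ , onto) (bounds , _) = proj₂ (All.lookup bounds (onto (suc m) (s≤s z≤n) ≤-refl))

withMax-singleton : ∀ {m a} → CayleyWithMax m [ a ] → a ≡ 1
withMax-singleton ((1≤a , a≤m) ∷ [] , onto) with onto 1 ≤-refl (≤-trans 1≤a a≤m)
... | here 1≡a = sym 1≡a

withMax-keep : ∀ {m v a} → CayleyWithMax m v → 1 ≤ a → a ≤ m → CayleyWithMax m (v ∷ʳ a)
withMax-keep (bounds , onto) 1≤a a≤m =
  All.++⁺ bounds ((1≤a , a≤m) ∷ []) , λ k 1≤k k≤m → ∈-++⁺ˡ (onto k 1≤k k≤m)

withMax-init : ∀ {m v a} → CayleyWithMax m (v ∷ʳ a) → a ∈ v → CayleyWithMax m v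
withMax-init {v = v} (bounds , onto) a∈v = All.++⁻ˡ v bounds , onto′
  where
  onto′ : ∀ k → 1 ≤ k → k ≤ _ → k ∈ v
  onto′ k 1≤k k≤m with ∈-++⁻ v (onto k 1≤k k≤m)
  ... | inj₁ k∈v         = k∈v
  ... | inj₂ (here refl) = a∈v

withMax-raise : ∀ {m v a} → CayleyWithMax m v → 1 ≤ a → a ≤ suc m →
                CayleyWithMax (suc m) (map (bump a) v ∷ʳ a)
withMax-raise {m} {v} {a} (bounds , onto) 1≤a a≤sm =
  All.++⁺ (All.map⁺ (All.map bumpBounds bounds)) ((1≤a , a≤sm) ∷ []) , onto′
  where
  bumpBounds : ∀ {y} → 1 ≤ y × y ≤ m → 1 ≤ bump a y × bump a y ≤ suc m
  bumpBounds {y} (1≤y , y≤m) with a ≤? y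
  ... | yes a≤y rewrite bump-≥ a≤y = m≤n⇒m≤1+n 1≤y , s≤s y≤m
  ... | no  a≰y rewrite bump-< (≰⇒> a≰y) = 1≤y , m≤n⇒m≤1+n y≤m
  onto′ : ∀ k → 1 ≤ k → k ≤ suc m → k ∈ map (bump a) v ∷ʳ a
  onto′ k 1≤k k≤sm with <-cmp k a
  ... | tri< k<a _ _ =
    ∈-++⁺ˡ (subst (_∈ map (bump a) v) (bump-< k<a) (∈-map⁺ (bump a) (onto k 1≤k (≤-pred (≤-trans k<a a≤sm)))))
  ... | tri≈ _ refl _ = ∈-++⁺ʳ (map (bump a) v) (here refl)
  ... | tri> _ _ (s≤s {n = k′} a≤k′) =
    ∈-++⁺ˡ (subst (_∈ map (bump a) v) (bump-≥ a≤k′)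
              (∈-map⁺ (bump a) (onto k′ (≤-trans 1≤a a≤k′) (≤-pred k≤sm))))

withMax-unbump : ∀ {m v a} → CayleyWithMax m (v ∷ʳ a) → a ∉ v → CayleyWithMax (pred m) (map (unbump a) v)
withMax-unbump {zero} {v} (bounds , _) _ with All.lookup bounds (∈-++⁺ʳ v (here refl))
... | 1≤a , a≤0 = ⊥-elim (<⇒≱ 1≤a a≤0)
withMax-unbump {suc m} {v} {a} (bounds , onto) a∉v =
  All.map⁺ (All.tabulate (λ {y} y∈v → unbumpBounds (λ { refl → a∉v y∈v }) (All.lookup bounds (∈-++⁺ˡ y∈v)))) ,
  onto′
  where
  1≤a : 1 ≤ a
  1≤a = proj₁ (All.lookup bounds (∈-++⁺ʳ v (here refl)))
  unbumpBounds : ∀ {y} → y ≢ a → 1 ≤ y × y ≤ suc m → 1 ≤ unbump a y × unbump a y ≤ m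
  unbumpBounds {y} y≢a (1≤y , y≤sm) with <-cmp y a
  ... | tri< y<a _ _ rewrite unbump-< y<a = 1≤y , ≤-pred (≤-trans y<a (proj₂ (All.lookup bounds (∈-++⁺ʳ v (here refl)))))
  ... | tri≈ _ y≡a _ = ⊥-elim (y≢a y≡a)
  ... | tri> _ _ (s≤s {n = y′} a≤y′) rewrite unbump-≥ (m≤n⇒m≤1+n a≤y′) = ≤-trans 1≤a a≤y′ , ≤-pred y≤sm
  fromOnto : ∀ c → 1 ≤ c → c ≤ suc m → c ≢ a → c ∈ v
  fromOnto c 1≤c c≤sm c≢a with ∈-++⁻ v (onto c 1≤c c≤sm)
  ... | inj₁ c∈v          = c∈v
  ... | inj₂ (here c≡a)   = ⊥-elim (c≢a c≡a)
  -- k is the image of k below a and of k + 1 from a on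
  onto′ : ∀ k → 1 ≤ k → k ≤ m → k ∈ map (unbump a) v
  onto′ k 1≤k k≤m with k <? a
  ... | yes k<a = subst (_∈ map (unbump a) v) (unbump-< k<a)
                    (∈-map⁺ (unbump a) (fromOnto k 1≤k (m≤n⇒m≤1+n k≤m) (<⇒≢ k<a)))
  ... | no  k≮a = subst (_∈ map (unbump a) v) (unbump-≥ (m≤n⇒m≤1+n (≮⇒≥ k≮a)))
                    (∈-map⁺ (unbump a) (fromOnto (suc k) (s≤s z≤n) (s≤s k≤m)
                                                 (λ sk≡a → k≮a (subst (k <_) sk≡a ≤-refl))))

-- Modified ascent sequences are the Cayley permutations avoiding 𝔞 and 𝔟

AscInvariant : List ℕ → Set
AscInvariant x = CayleyWithMax (suc (asc x)) x × ¬ ContainsA x × ¬ ContainsB x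

invariant-keep : ∀ u b a → AscInvariant (u ∷ʳ b) → 1 ≤ a → a ≤ b → AscInvariant (u ∷ʳ b ∷ʳ a)
invariant-keep u b a (c , noA , noB) 1≤a a≤b =
  subst (λ t → CayleyWithMax (suc t) (u ∷ʳ b ∷ʳ a)) (sym (asc-keep (u ∷ʳ b) (last-∷ʳ u b) a≤b))
        (withMax-keep c 1≤a a≤m) ,
  noA′ , noB′
  where
  a≤m = ≤-trans a≤b (proj₂ (All.lookup (proj₁ c) (∈-++⁺ʳ u (here refl))))
  noA′ : ¬ ContainsA (u ∷ʳ b ∷ʳ a)
  noA′ A with Equivalence.to (ContainsA-∷ʳ⇔ u b a) A
  ... | inj₁ A′         = noA A′
  ... | inj₂ (b<a , _)  = <⇒≱ b<a a≤b
  noB′ : ¬ ContainsB (u ∷ʳ b ∷ʳ a)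
  noB′ B with Equivalence.to (ContainsB-∷ʳ⇔ u b a) B
  ... | inj₁ B′           = noB B′
  ... | inj₂ (a<b , a∉u) with ∈-++⁻ u (proj₂ c a 1≤a a≤m)
  ...   | inj₁ a∈u         = a∉u a∈u
  ...   | inj₂ (here refl) = <-irrefl refl a<b

invariant-raise : ∀ u b a → AscInvariant (u ∷ʳ b) → b < a → a ≤ 2 + asc (u ∷ʳ b) →
                  AscInvariant (map (bump a) (u ∷ʳ b) ∷ʳ a)
invariant-raise u b a (c , noA , noB) b<a a≤ =
  subst (λ t → CayleyWithMax t (map (bump a) v ∷ʳ a)) (cong suc (sym (asc-raise v (last-∷ʳ u b) b<a)))
    (withMax-raise c (≤-trans (s≤s z≤n) b<a) a≤) ,
  noA′ , noB′
  where
  v = u ∷ʳ b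
  u′ = map (bump a) u
  via-u′ : ∀ (P : List ℕ → Set) → P (map (bump a) v ∷ʳ a) → P (u′ ∷ʳ b ∷ʳ a)
  via-u′ P = subst (λ t → P (t ∷ʳ a)) (map-bump-∷ʳ u b<a)
  noA′ : ¬ ContainsA (map (bump a) v ∷ʳ a)
  noA′ A with Equivalence.to (ContainsA-∷ʳ⇔ u′ b a) (via-u′ ContainsA A)
  ... | inj₁ A′ = noA (Equivalence.to (ContainsA-map⇔ (bump-mono a) v) (subst ContainsA (sym (map-bump-∷ʳ u b<a)) A′))
  ... | inj₂ (_ , a∈u′) with ∈-map⁻ (bump a) a∈u′
  ...   | y , _ , a≡bump = bump≢ a y (sym a≡bump)
  noB′ : ¬ ContainsB (map (bump a) v ∷ʳ a)
  noB′ B with Equivalence.to (ContainsB-∷ʳ⇔ u′ b a) (via-u′ ContainsB B)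
  ... | inj₁ B′ = noB (Equivalence.to (ContainsB-map⇔ (bump-mono a) v) (subst ContainsB (sym (map-bump-∷ʳ u b<a)) B′))
  ... | inj₂ (a<b , _) = <-asym a<b b<a

modAsc⇒invariant : ∀ {x c} → ModAsc x → last x ≡ just c → AscInvariant x
modAsc⇒invariant one _ =
  ((s≤s z≤n , s≤s z≤n) ∷ [] , λ k 1≤k k≤1 → here (≤-antisym k≤1 1≤k)) ,
  (λ { (_ , _ , _ , s≤s () , _) }) , (λ { (_ , s≤s () , _) })
modAsc⇒invariant (keep {v} {a = a} mv lv 1≤a a≤b) _ with last⇒∷ʳ {v = v} lv
... | u , refl = invariant-keep u _ a (modAsc⇒invariant mv lv) 1≤a a≤b
modAsc⇒invariant (raise {v} {a = a} mv lv b<a a≤) _ with last⇒∷ʳ {v = v} lv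
... | u , refl = invariant-raise u _ a (modAsc⇒invariant mv lv) b<a a≤

invariant⇒cayleyAB : ∀ {x} → AscInvariant x → CayleyAB x
invariant⇒cayleyAB (c , noA , noB) = withMax⇒Cayley _ c , noA , noB

modAsc⇒cayleyAB : ∀ {x} → ModAsc x → CayleyAB x
modAsc⇒cayleyAB empty = ([] , λ { _ (s≤s _) () }) , (λ { (_ , _ , _ , () , _) }) , (λ { (_ , () , _) })
modAsc⇒cayleyAB mx@one = invariant⇒cayleyAB (modAsc⇒invariant mx refl)
modAsc⇒cayleyAB mx@(keep {v} {a = a} _ _ _ _) = invariant⇒cayleyAB (modAsc⇒invariant mx (last-∷ʳ v a))
modAsc⇒cayleyAB mx@(raise {v} {a = a} _ _ _ _) =
  invariant⇒cayleyAB (modAsc⇒invariant mx (last-∷ʳ (map (bump a) v) a))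

avoidB⇒∈ : ∀ u b a → ¬ ContainsB (u ∷ʳ b ∷ʳ a) → a ≤ b → a ∈ u ∷ʳ b
avoidB⇒∈ u b a noB a≤b with a ∈? u
... | yes a∈u = ∈-++⁺ˡ a∈u
... | no  a∉u with m≤n⇒m<n∨m≡n a≤b
...   | inj₁ a<b  = ⊥-elim (noB (Equivalence.from (ContainsB-∷ʳ⇔ u b a) (inj₂ (a<b , a∉u))))
...   | inj₂ refl = ∈-++⁺ʳ u (here refl)

avoidA⇒∉ : ∀ u b a → ¬ ContainsA (u ∷ʳ b ∷ʳ a) → b < a → a ∉ u ∷ʳ b
avoidA⇒∉ u b a noA b<a a∈v with ∈-++⁻ u a∈v
... | inj₁ a∈u         = noA (Equivalence.from (ContainsA-∷ʳ⇔ u b a) (inj₂ (b<a , a∈u)))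
... | inj₂ (here refl) = <-irrefl refl b<a

¬ContainsA-unbump : ∀ {v a} → a ∉ v → ¬ ContainsA (v ∷ʳ a) → ¬ ContainsA (map (unbump a) v)
¬ContainsA-unbump {v} {a} a∉v noA =
  noA ∘ ContainsA-++ v [ a ] ∘ subst ContainsA (map-bump-unbump a v a∉v)
      ∘ Equivalence.from (ContainsA-map⇔ (bump-mono a) (map (unbump a) v))

¬ContainsB-unbump : ∀ {v a} → a ∉ v → ¬ ContainsB (v ∷ʳ a) → ¬ ContainsB (map (unbump a) v)
¬ContainsB-unbump {v} {a} a∉v noB =
  noB ∘ ContainsB-++ v [ a ] ∘ subst ContainsB (map-bump-unbump a v a∉v)
      ∘ Equivalence.from (ContainsB-map⇔ (bump-mono a) (map (unbump a) v))

-- The bound of the raise step comes from max = 1 + asc for the shorter sequence.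
modAsc-unbump⇒modAsc : ∀ {m u b a} → b < a → a ∉ u ∷ʳ b → CayleyWithMax m (u ∷ʳ b ∷ʳ a) →
                       ModAsc (map (unbump a) (u ∷ʳ b)) → ModAsc (u ∷ʳ b ∷ʳ a)
modAsc-unbump⇒modAsc {m} {u} {b} {a} b<a a∉v c mv′ =
  subst (λ t → ModAsc (t ∷ʳ a)) (map-bump-unbump a v a∉v) (raise mv′ last-v′ b<a (subst (a ≤_) m≡2+asc a≤m))
  where
  v = u ∷ʳ b
  last-v′ : last (map (unbump a) v) ≡ just b
  last-v′ = trans (last-map (unbump a) v) (trans (cong (Maybe.map (unbump a)) (last-∷ʳ u b)) (cong just (unbump-< b<a)))
  a≤m : a ≤ m
  a≤m = proj₂ (All.lookup (proj₁ c) (∈-++⁺ʳ v (here refl)))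
  m≡2+asc : m ≡ 2 + asc (map (unbump a) v)
  m≡2+asc = trans (sym (suc-pred m {{>-nonZero (≤-trans (≤-trans (s≤s z≤n) b<a) a≤m)}}))
                  (cong suc (withMax-unique (withMax-unbump c a∉v) (proj₁ (modAsc⇒invariant mv′ last-v′))))

avoiding⇒modAsc : ∀ n {m} x → length x ≡ n → CayleyWithMax m x → ¬ ContainsA x → ¬ ContainsB x → ModAsc x
avoiding⇒modAsc n x len c noA noB with initLast x
avoiding⇒modAsc n .[] _ _ _ _ | [] = empty
avoiding⇒modAsc n .(v ∷ʳ a) len c noA noB | v ∷ʳ′ a with initLast v
avoiding⇒modAsc n .([] ∷ʳ a) len c noA noB | .[] ∷ʳ′ a | [] rewrite withMax-singleton c = one
avoiding⇒modAsc zero .(u ∷ʳ b ∷ʳ a) len c noA noB | .(u ∷ʳ b) ∷ʳ′ a | u ∷ʳ′ b =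
  ⊥-elim (1+n≢0 (trans (sym (length-∷ʳ (u ∷ʳ b) a)) len))
avoiding⇒modAsc (suc n) .(u ∷ʳ b ∷ʳ a) len c noA noB | .(u ∷ʳ b) ∷ʳ′ a | u ∷ʳ′ b with a ≤? b
... | yes a≤b =
  keep (avoiding⇒modAsc n v len-v (withMax-init c (avoidB⇒∈ u b a noB a≤b))
                        (noA ∘ ContainsA-++ v [ a ]) (noB ∘ ContainsB-++ v [ a ]))
       (last-∷ʳ u b) (proj₁ (All.lookup (proj₁ c) (∈-++⁺ʳ v (here refl)))) a≤b
  where
  v = u ∷ʳ b
  len-v = suc-injective (trans (sym (length-∷ʳ v a)) len)
... | no a≰b =
  modAsc-unbump⇒modAsc b<a a∉v c
    (avoiding⇒modAsc n (map (unbump a) v) (trans (length-map (unbump a) v) len-v) (withMax-unbump c a∉v)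
                     (¬ContainsA-unbump a∉v noA) (¬ContainsB-unbump a∉v noB))
  where
  v = u ∷ʳ b
  len-v = suc-injective (trans (sym (length-∷ʳ v a)) len)
  b<a = ≰⇒> a≰b
  a∉v = avoidA⇒∉ u b a noA b<a

cayleyAB⇒modAsc : ∀ {x} → CayleyAB x → ModAsc x
cayleyAB⇒modAsc {x} (c , noA , noB) = avoiding⇒modAsc (length x) x refl (Cayley⇒withMax x c) noA noB

modAsc⇔cayleyAB : ∀ x → ModAsc x ⇔ CayleyAB x
modAsc⇔cayleyAB x = mk⇔ modAsc⇒cayleyAB cayleyAB⇒modAsc

-- Generating modified ascent sequences

map-unique : ∀ {A B : Set} {f : A → B} {xs} →
             (∀ {x y} → x ∈ xs → y ∈ xs → f x ≡ f y → x ≡ y) → Unique xs → Unique (map f xs)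
map-unique inj []         = []
map-unique inj (x∉ ∷ xs!) =
  All.map⁺ (All.tabulate (λ y∈ fx≡fy → All.lookup x∉ y∈ (inj (here refl) (there y∈) fx≡fy))) ∷
  map-unique (λ x∈ y∈ → inj (there x∈) (there y∈)) xs!

concatMap-unique : ∀ {A B : Set} (f : A → List B) {xs} → Unique xs → (∀ {x} → x ∈ xs → Unique (f x)) →
                   (∀ {x y z} → x ∈ xs → y ∈ xs → z ∈ f x → z ∈ f y → x ≡ y) → Unique (concatMap f xs)
concatMap-unique f []         _  _   = []
concatMap-unique f {x ∷ xs} (x∉ ∷ xs!) f! sep =
  Unique.++⁺ (f! (here refl)) (concatMap-unique f xs! (f! ∘ there) (λ x∈ y∈ → sep (there x∈) (there y∈))) disjoint
  where
  disjoint : ∀ {z} → ¬ (z ∈ f x × z ∈ concatMap f xs)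
  disjoint (z∈fx , z∈rest) with find (∈-concatMap⁻ f z∈rest)
  ... | y , y∈ , z∈fy = All.lookup x∉ y∈ (sep (here refl) (there y∈) z∈fx z∈fy)

lastLetter : List ℕ → ℕ
lastLetter x = fromMaybe 0 (last x)

nonEmpty⇒last : ∀ {x} → x ≢ [] → last x ≡ just (lastLetter x)
nonEmpty⇒last {[]}        x≢[] = ⊥-elim (x≢[] refl)
nonEmpty⇒last {c ∷ []}    _    = refl
nonEmpty⇒last {c ∷ d ∷ x} _    = nonEmpty⇒last {d ∷ x} (λ ())

lastLetter-just : ∀ x {b} → last x ≡ just b → lastLetter x ≡ b
lastLetter-just x = cong (fromMaybe 0)

lastLetter-map-bump : ∀ {a} y → lastLetter y < a → lastLetter (map (bump a) y) ≡ lastLetter y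
lastLetter-map-bump {a} y rewrite last-map (bump a) y with last y
... | nothing = λ _ → refl
... | just c  = bump-<

≢-map-bump : ∀ {a x} y → a ≤ lastLetter x → lastLetter y < a → x ≢ map (bump a) y
≢-map-bump {a} y a≤x y<a refl = <⇒≱ y<a (subst (a ≤_) (lastLetter-map-bump y y<a) a≤x)

extend : List ℕ → ℕ → List ℕ
extend x a = (if a ≤ᵇ lastLetter x then x else map (bump a) x) ∷ʳ a

extend-≤ : ∀ x {a} → a ≤ lastLetter x → extend x a ≡ x ∷ʳ a
extend-≤ x a≤ rewrite ≤ᵇ-true a≤ = refl

extend-> : ∀ x {a} → lastLetter x < a → extend x a ≡ map (bump a) x ∷ʳ a
extend-> x <a rewrite ≤ᵇ-false <a = refl

length-extend : ∀ x a → length (extend x a) ≡ suc (length x)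
length-extend x a with a ≤? lastLetter x
... | yes a≤ rewrite extend-≤ x a≤ = length-∷ʳ x a
... | no  a≰ rewrite extend-> x (≰⇒> a≰) = trans (length-∷ʳ (map (bump a) x) a) (cong suc (length-map (bump a) x))

lastLetter-extend : ∀ x a → lastLetter (extend x a) ≡ a
lastLetter-extend x a = cong (fromMaybe 0) (last-∷ʳ (if a ≤ᵇ lastLetter x then x else map (bump a) x) a)

extend-injective : ∀ x y {a b} → extend x a ≡ extend y b → x ≡ y × a ≡ b
extend-injective x y {a} eq with ∷ʳ-injective _ _ eq
... | body≡ , refl with a ≤? lastLetter x | a ≤? lastLetter y
... | yes a≤x | yes a≤y rewrite ≤ᵇ-true a≤x | ≤ᵇ-true a≤y = body≡ , refl
... | no  a≰x | no  a≰y rewrite ≤ᵇ-false (≰⇒> a≰x) | ≤ᵇ-false (≰⇒> a≰y) =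
  map-injective (mono-injective (bump-mono a)) body≡ , refl
... | yes a≤x | no  a≰y rewrite ≤ᵇ-true a≤x | ≤ᵇ-false (≰⇒> a≰y) =
  ⊥-elim (≢-map-bump y a≤x (≰⇒> a≰y) body≡)
... | no  a≰x | yes a≤y rewrite ≤ᵇ-false (≰⇒> a≰x) | ≤ᵇ-true a≤y =
  ⊥-elim (≢-map-bump x a≤y (≰⇒> a≰x) (sym body≡))

children : List ℕ → List (List ℕ)
children x = map (extend x ∘ suc) (upTo (2 + asc x))

modAscs : ℕ → List (List ℕ)
modAscs zero          = [ [] ]
modAscs (suc zero)    = [ [ 1 ] ]
modAscs (suc (suc n)) = concatMap children (modAscs (suc n))

extend-modAsc : ∀ {x a} → ModAsc x → x ≢ [] → 1 ≤ a → a ≤ 2 + asc x → ModAsc (extend x a)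
extend-modAsc {x} {a} mx x≢[] 1≤a a≤ with a ≤? lastLetter x
... | yes a≤b rewrite extend-≤ x a≤b = keep mx (nonEmpty⇒last x≢[]) 1≤a a≤b
... | no  a≰b rewrite extend-> x (≰⇒> a≰b) = raise mx (nonEmpty⇒last x≢[]) (≰⇒> a≰b) a≤

children-modAsc : ∀ x {y} → ModAsc x → x ≢ [] → y ∈ children x → ModAsc y
children-modAsc x mx x≢[] y∈ with ∈-map⁻ _ y∈
... | a , a∈ , refl = extend-modAsc mx x≢[] (s≤s z≤n) (∈-upTo⁻ a∈)

length-children : ∀ x {y} → y ∈ children x → length y ≡ suc (length x)
length-children x y∈ with ∈-map⁻ _ y∈
... | a , _ , refl = length-extend x (suc a)

∈-modAscs⇒modAsc : ∀ n {x} → x ∈ modAscs n → length x ≡ n × ModAsc x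
∈-modAscs⇒modAsc zero          (here refl) = refl , empty
∈-modAscs⇒modAsc (suc zero)    (here refl) = refl , one
∈-modAscs⇒modAsc (suc (suc n)) x∈ =
  let v , v∈ , x∈v = find (∈-concatMap⁻ children x∈)
      len , mv     = ∈-modAscs⇒modAsc (suc n) v∈
  in trans (length-children v x∈v) (cong suc len) ,
     children-modAsc v mv (λ v≡[] → 1+n≢0 (trans (sym len) (cong length v≡[]))) x∈v

∈-children⇒∈-modAscs : ∀ {v y} → v ≢ [] → v ∈ modAscs (length v) → y ∈ children v → y ∈ modAscs (suc (length v))
∈-children⇒∈-modAscs {[]}    v≢[] _  _  = ⊥-elim (v≢[] refl)
∈-children⇒∈-modAscs {_ ∷ _} _    v∈ y∈ = ∈-concatMap⁺ children (lose v∈ y∈)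

modAsc⇒∈-modAscs : ∀ {x} → ModAsc x → x ∈ modAscs (length x)
modAsc⇒∈-modAscs empty = here refl
modAsc⇒∈-modAscs one   = here refl
modAsc⇒∈-modAscs (keep {v} {b} {suc a} mv lv _ a≤b) =
  subst (λ n → v ∷ʳ suc a ∈ modAscs n) (sym (length-∷ʳ v (suc a)))
    (∈-children⇒∈-modAscs v≢[] (modAsc⇒∈-modAscs mv)
      (subst (_∈ children v) (extend-≤ v (subst (suc a ≤_) (sym (lastLetter-just v lv)) a≤b))
        (∈-map⁺ (extend v ∘ suc) (∈-upTo⁺ (≤-trans a≤b (m≤n⇒m≤1+n b≤))))))
  where
  v≢[] = λ { refl → case lv of λ () }
  b≤ : b ≤ suc (asc v)
  b≤ = proj₂ (All.lookup (proj₁ (proj₁ (modAsc⇒invariant mv lv))) (last⇒∈ lv))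
modAsc⇒∈-modAscs (raise {v} {b} {suc a} mv lv b<a a≤) =
  subst (λ n → map (bump (suc a)) v ∷ʳ suc a ∈ modAscs n)
    (sym (trans (length-∷ʳ (map (bump (suc a)) v) (suc a)) (cong suc (length-map (bump (suc a)) v))))
    (∈-children⇒∈-modAscs v≢[] (modAsc⇒∈-modAscs mv)
      (subst (_∈ children v) (extend-> v (subst (_< suc a) (sym (lastLetter-just v lv)) b<a))
        (∈-map⁺ (extend v ∘ suc) (∈-upTo⁺ a≤))))
  where
  v≢[] = λ { refl → case lv of λ () }

modAscs-unique : ∀ n → Unique (modAscs n)
modAscs-unique zero          = [] ∷ []
modAscs-unique (suc zero)    = [] ∷ []
modAscs-unique (suc (suc n)) =
  concatMap-unique children (modAscs-unique (suc n))
    (λ {x} _ → Unique.map⁺ (λ eq → suc-injective (proj₂ (extend-injective x x eq))) (Unique.upTo⁺ _))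
    (λ _ _ z∈x z∈y → parent z∈x z∈y)
  where
  parent : ∀ {x y z} → z ∈ children x → z ∈ children y → x ≡ y
  parent {x} {y} z∈x z∈y with ∈-map⁻ _ z∈x | ∈-map⁻ _ z∈y
  ... | _ , _ , refl | _ , _ , eq = proj₁ (extend-injective x y eq)

modAscs-enumerates : ∀ n → Enumerates (λ x → length x ≡ n × CayleyAB x) (modAscs n)
modAscs-enumerates n = modAscs-unique n , λ x → mk⇔
  (λ x∈ → let len , mx = ∈-modAscs⇒modAsc n x∈ in len , modAsc⇒cayleyAB mx)
  (λ { (refl , cx) → modAsc⇒∈-modAscs (cayleyAB⇒modAsc cx) })

-- Generating Fishburn permutations

FishburnPattern : List ℕ → Set
FishburnPattern π = ∃[ i ] ∃[ k ] (suc i < k × k < length π ×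
                      π ! k < π ! i × π ! i < π ! suc i × π ! i ≡ suc (π ! k))

-- Inserting a larger letter right after y, followed by r, creates the pattern iff y − 1 occurs in r.
activeAfter : ℕ → List ℕ → Bool
activeAfter zero    _ = true
activeAfter (suc w) r = not (does (w ∈? r))

okPair : ℕ → ℕ → List ℕ → Bool
okPair y z r = not (suc y ≤ᵇ z) ∨ activeAfter y r

fishburnᵇ : List ℕ → Bool
fishburnᵇ (y ∷ z ∷ r) = okPair y z r ∧ fishburnᵇ (z ∷ r)
fishburnᵇ _           = true

pattern⇒okPair≡false : ∀ {w z r} → suc w < z → w ∈ r → okPair (suc w) z r ≡ false
pattern⇒okPair≡false {w} {z} {r} w<z w∈r rewrite ≤ᵇ-true w<z | dec-true (w ∈? r) w∈r = refl

okPair≡false⇒pattern : ∀ y z r → okPair y z r ≡ false → FishburnPattern (y ∷ z ∷ r)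
okPair≡false⇒pattern zero    z r eq = case ∨-conicalʳ (not (1 ≤ᵇ z)) true eq of λ ()
okPair≡false⇒pattern (suc w) z r eq with w ∈? r | suc (suc w) ≤? z
... | no  _   | _       = case ∨-conicalʳ (not (suc (suc w) ≤ᵇ z)) true eq of λ ()
... | yes _   | no  w≮z rewrite ≤ᵇ-false (≰⇒> w≮z) = case eq of λ ()
... | yes w∈r | yes w<z with ∈⇒! w∈r
...   | t , t< , rt≡w = 0 , 2 + t , s≤s (s≤s z≤n) , s≤s (s≤s t<) ,
                        subst (_< suc w) (sym rt≡w) ≤-refl , w<z , cong suc (sym rt≡w)

∧≡false : ∀ a {b} → a ∧ b ≡ false → a ≡ false ⊎ b ≡ false
∧≡false false _  = inj₁ refl
∧≡false true  eq = inj₂ eq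

pattern-∷ : ∀ {y π} → FishburnPattern π → FishburnPattern (y ∷ π)
pattern-∷ (i , k , i<k , k< , rest) = suc i , suc k , s≤s i<k , s≤s k< , rest

fishburnᵇ≡false⇒pattern : ∀ π → fishburnᵇ π ≡ false → FishburnPattern π
fishburnᵇ≡false⇒pattern (y ∷ z ∷ r) eq =
  either (okPair≡false⇒pattern y z r) (pattern-∷ ∘ fishburnᵇ≡false⇒pattern (z ∷ r)) (∧≡false (okPair y z r) eq)

fishburnᵇ≡true⇒¬pattern : ∀ π → fishburnᵇ π ≡ true → ¬ FishburnPattern π
fishburnᵇ≡true⇒¬pattern []          _  (_ , _ , _ , () , _)
fishburnᵇ≡true⇒¬pattern (y ∷ [])     _  (_ , zero , () , _)
fishburnᵇ≡true⇒¬pattern (y ∷ [])     _  (_ , suc _ , _ , s≤s () , _)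
fishburnᵇ≡true⇒¬pattern (y ∷ z ∷ r) eq (zero , suc zero , s≤s () , _)
fishburnᵇ≡true⇒¬pattern (y ∷ z ∷ r) eq (zero , suc (suc t) , _ , s≤s (s≤s t<) , _ , y<z , refl) =
  case trans (sym (∧-conicalˡ _ _ eq)) (pattern⇒okPair≡false y<z (!-∈ r t<)) of λ ()
fishburnᵇ≡true⇒¬pattern (y ∷ z ∷ r) eq (suc i , suc k , s≤s i<k , s≤s k< , rest) =
  fishburnᵇ≡true⇒¬pattern (z ∷ r) (∧-conicalʳ _ _ eq) (i , k , i<k , k< , rest)

Fishburn⇔fishburnᵇ : ∀ π → Fishburn π ⇔ (fishburnᵇ π ≡ true)
Fishburn⇔fishburnᵇ π = mk⇔ to (fishburnᵇ≡true⇒¬pattern π)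
  where
  to : Fishburn π → fishburnᵇ π ≡ true
  to noPattern with fishburnᵇ π in eq
  ... | true  = refl
  ... | false = ⊥-elim (noPattern (fishburnᵇ≡false⇒pattern π eq))

insert : ℕ → ℕ → List ℕ → List ℕ
insert k N σ = take k σ ++ N ∷ drop k σ

-- sites σ lists, for each of the length σ + 1 gaps of σ, whether inserting a new maximum
-- there keeps σ Fishburn: the front gap always does.
sitesAfter : List ℕ → List Bool
sitesAfter []      = []
sitesAfter (y ∷ r) = activeAfter y r ∷ sitesAfter r

sites : List ℕ → List Bool
sites σ = true ∷ sitesAfter σ

_!ᵇ_ : List Bool → ℕ → Bool
[]       !ᵇ _     = false
(b ∷ _)  !ᵇ zero  = b
(_ ∷ bs) !ᵇ suc k = bs !ᵇ k

length-sitesAfter : ∀ σ → length (sitesAfter σ) ≡ length σ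
length-sitesAfter []      = refl
length-sitesAfter (y ∷ σ) = cong suc (length-sitesAfter σ)

∈-insert⇔ : ∀ {w N} k σ → w ≢ N → w ∈ insert k N σ ⇔ w ∈ σ
∈-insert⇔ zero    σ       w≢N = mk⇔ (λ { (here w≡N) → ⊥-elim (w≢N w≡N) ; (there w∈) → w∈ }) there
∈-insert⇔ (suc k) []      w≢N = mk⇔ (λ { (here w≡N) → ⊥-elim (w≢N w≡N) ; (there ()) }) (λ ())
∈-insert⇔ (suc k) (y ∷ σ) w≢N = mk⇔
  (λ { (here w≡y) → here w≡y ; (there w∈) → there (Equivalence.to (∈-insert⇔ k σ w≢N) w∈) })
  (λ { (here w≡y) → here w≡y ; (there w∈) → there (Equivalence.from (∈-insert⇔ k σ w≢N) w∈) })

activeAfter-insert : ∀ {y n} k σ → y ≤ n → activeAfter y (insert k (suc n) σ) ≡ activeAfter y σ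
activeAfter-insert {zero}  k σ _       = refl
activeAfter-insert {suc w} k σ (s≤s w≤) =
  cong not (does-⇔ (∈-insert⇔ k σ (λ w≡N → <-irrefl w≡N (s≤s (m≤n⇒m≤1+n w≤)))) (w ∈? insert k _ σ) (w ∈? σ))

activeAfter-∷ : ∀ y z r → activeAfter y (z ∷ r) ≡ true → activeAfter y r ≡ true
activeAfter-∷ zero    z r _  = refl
activeAfter-∷ (suc w) z r eq = cong not (dec-false (w ∈? r) (w∉ ∘ there))
  where
  w∉ : w ∉ z ∷ r
  w∉ w∈ = case trans (sym eq) (cong not (dec-true (w ∈? (z ∷ r)) w∈)) of λ ()

fishburnᵇ-max : ∀ n σ → All (_≤ n) σ → fishburnᵇ (suc n ∷ σ) ≡ fishburnᵇ σ
fishburnᵇ-max n []      _        = refl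
fishburnᵇ-max n (z ∷ r) (z≤ ∷ _) rewrite ≤ᵇ-false {suc (suc n)} (s≤s (m≤n⇒m≤1+n z≤)) = refl

activeAfter∧≡ : ∀ y z r F → activeAfter y (z ∷ r) ∧ F ≡ (okPair y z r ∧ F) ∧ activeAfter y (z ∷ r)
activeAfter∧≡ y z r F with activeAfter y (z ∷ r) in active
... | true  rewrite activeAfter-∷ y z r active | ∨-zeroʳ (not (suc y ≤ᵇ z)) = sym (∧-identityʳ F)
... | false = sym (∧-zeroʳ _)

fishburnᵇ-insert : ∀ n k σ → All (_≤ n) σ → k ≤ length σ →
                   fishburnᵇ (insert k (suc n) σ) ≡ fishburnᵇ σ ∧ (sites σ !ᵇ k)
fishburnᵇ-insert n zero σ σ≤n _ = trans (fishburnᵇ-max n σ σ≤n) (sym (∧-identityʳ _))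
fishburnᵇ-insert n (suc zero) (y ∷ []) (y≤n ∷ _) _ rewrite ≤ᵇ-true (s≤s y≤n) with y
... | zero  = refl
... | suc w = refl
fishburnᵇ-insert n (suc zero) (y ∷ z ∷ r) (y≤n ∷ σ≤n) _ rewrite ≤ᵇ-true (s≤s y≤n) =
  trans (cong (activeAfter y (z ∷ r) ∧_) (fishburnᵇ-max n (z ∷ r) σ≤n)) (activeAfter∧≡ y z r (fishburnᵇ (z ∷ r)))
fishburnᵇ-insert n (suc (suc k)) (y ∷ z ∷ σ) (y≤n ∷ σ≤n) (s≤s k≤) rewrite activeAfter-insert k σ y≤n =
  trans (cong (okPair y z σ ∧_) (fishburnᵇ-insert n (suc k) (z ∷ σ) σ≤n k≤)) (sym (∧-assoc (okPair y z σ) _ _))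

bit : Bool → ℕ
bit true  = 1
bit false = 0

countTrue : List Bool → ℕ
countTrue []       = 0
countTrue (b ∷ bs) = bit b + countTrue bs

countTrue-take-suc : ∀ k bs → countTrue (take (suc k) bs) ≡ countTrue (take k bs) + bit (bs !ᵇ k)
countTrue-take-suc zero    []       = refl
countTrue-take-suc (suc k) []       = refl
countTrue-take-suc zero    (b ∷ bs) = +-identityʳ (bit b)
countTrue-take-suc (suc k) (b ∷ bs) = trans (cong (bit b +_) (countTrue-take-suc k bs)) (sym (+-assoc (bit b) _ _))

countTrue-take-mono : ∀ {m m′} bs → m ≤ m′ → countTrue (take m bs) ≤ countTrue (take m′ bs)
countTrue-take-mono bs       z≤n      = z≤n
countTrue-take-mono []       (s≤s _)  = z≤n
countTrue-take-mono (b ∷ bs) (s≤s m≤) = +-monoʳ-≤ (bit b) (countTrue-take-mono bs m≤)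

countTrue-take-insert : ∀ n k σ → All (_≤ n) σ → k ≤ length σ →
  countTrue (take k (sitesAfter (insert k (suc n) σ))) ≡ countTrue (take k (sitesAfter σ))
countTrue-take-insert n zero    σ       _           _        = refl
countTrue-take-insert n (suc k) (y ∷ σ) (y≤n ∷ σ≤n) (s≤s k≤) =
  cong₂ _+_ (cong bit (activeAfter-insert k σ y≤n)) (countTrue-take-insert n k σ σ≤n k≤)

-- The only new site is the one right after the inserted maximum.
countTrue-insert : ∀ n k σ → All (_≤ n) σ → k ≤ length σ →
  countTrue (sitesAfter (insert k (suc n) σ)) ≡ countTrue (sitesAfter σ) + bit (activeAfter (suc n) (drop k σ))
countTrue-insert n zero    σ       _           _        = +-comm (bit (activeAfter (suc n) σ)) _
countTrue-insert n (suc k) (y ∷ σ) (y≤n ∷ σ≤n) (s≤s k≤) =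
  trans (cong₂ _+_ (cong bit (activeAfter-insert k σ y≤n)) (countTrue-insert n k σ σ≤n k≤))
        (sym (+-assoc (bit (activeAfter y σ)) _ _))

trueIndices : List Bool → List ℕ
trueIndices []           = []
trueIndices (true  ∷ bs) = zero ∷ map suc (trueIndices bs)
trueIndices (false ∷ bs) = map suc (trueIndices bs)

!ᵇ≡true⇒< : ∀ bs {k} → bs !ᵇ k ≡ true → k < length bs
!ᵇ≡true⇒< (b ∷ bs) {zero}  _  = s≤s z≤n
!ᵇ≡true⇒< (b ∷ bs) {suc k} eq = s≤s (!ᵇ≡true⇒< bs eq)

∈-trueIndices⁺ : ∀ bs {k} → bs !ᵇ k ≡ true → k ∈ trueIndices bs
∈-trueIndices⁺ (true  ∷ bs) {zero}  _  = here refl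
∈-trueIndices⁺ (true  ∷ bs) {suc k} eq = there (∈-map⁺ suc (∈-trueIndices⁺ bs eq))
∈-trueIndices⁺ (false ∷ bs) {suc k} eq = ∈-map⁺ suc (∈-trueIndices⁺ bs eq)

∈-trueIndices⁻ : ∀ bs {k} → k ∈ trueIndices bs → bs !ᵇ k ≡ true
∈-trueIndices⁻ (true  ∷ bs) (here refl) = refl
∈-trueIndices⁻ (true  ∷ bs) (there k∈) with ∈-map⁻ suc k∈
... | k , k∈′ , refl = ∈-trueIndices⁻ bs k∈′
∈-trueIndices⁻ (false ∷ bs) k∈ with ∈-map⁻ suc k∈
... | k , k∈′ , refl = ∈-trueIndices⁻ bs k∈′

0∉map-suc : ∀ xs → zero ∉ map suc xs
0∉map-suc (x ∷ xs) (here ())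
0∉map-suc (x ∷ xs) (there 0∈) = 0∉map-suc xs 0∈

trueIndices-unique : ∀ bs → Unique (trueIndices bs)
trueIndices-unique []           = []
trueIndices-unique (true  ∷ bs) =
  All.tabulate (λ 0∈ 0≡ → 0∉map-suc (trueIndices bs) (subst (_∈ _) (sym 0≡) 0∈)) ∷
  Unique.map⁺ suc-injective (trueIndices-unique bs)
trueIndices-unique (false ∷ bs) = Unique.map⁺ suc-injective (trueIndices-unique bs)

NthTrue : List Bool → ℕ → ℕ → Set
NthTrue bs a k = bs !ᵇ k ≡ true × countTrue (take k bs) ≡ a

trueIndices-nth : ∀ bs → Pointwise (NthTrue bs) (upTo (countTrue bs)) (trueIndices bs)
trueIndices-nth []           = []
trueIndices-nth (true  ∷ bs) =
  (refl , refl) ∷ subst (λ is → Pointwise (NthTrue (true ∷ bs)) is (map suc (trueIndices bs))) (map-upTo suc _)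
                    (Pointwise.map⁺ suc suc (Pointwise.map (λ (t , c) → t , cong suc c) (trueIndices-nth bs)))
trueIndices-nth (false ∷ bs) =
  subst (λ is → Pointwise (NthTrue (false ∷ bs)) is (map suc (trueIndices bs))) (map-id _)
    (Pointwise.map⁺ id suc (trueIndices-nth bs))

∈-drop⁻ : ∀ {A : Set} {x : A} j xs → x ∈ drop j xs → x ∈ xs
∈-drop⁻ zero    xs       x∈ = x∈
∈-drop⁻ (suc j) (y ∷ xs) x∈ = there (∈-drop⁻ j xs x∈)

∈-insert : ∀ k N σ → N ∈ insert k N σ
∈-insert k N σ = ∈-++⁺ʳ (take k σ) (here refl)

∈-drop-insert⇔ : ∀ {N} k σ → N ∉ σ → k ≤ length σ → ∀ j → N ∈ drop j (insert k N σ) ⇔ j ≤ k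
∈-drop-insert⇔ zero    σ       N∉ _        zero    = mk⇔ (λ _ → z≤n) (λ _ → here refl)
∈-drop-insert⇔ zero    σ       N∉ _        (suc j) = mk⇔ (λ N∈ → ⊥-elim (N∉ (∈-drop⁻ j σ N∈))) (λ ())
∈-drop-insert⇔ (suc k) (y ∷ σ) N∉ _        zero    = mk⇔ (λ _ → z≤n) (λ _ → there (∈-insert k _ σ))
∈-drop-insert⇔ (suc k) (y ∷ σ) N∉ (s≤s k≤) (suc j) =
  mk⇔ (s≤s ∘ Equivalence.to IH) (Equivalence.from IH ∘ ≤-pred)
  where IH = ∈-drop-insert⇔ k σ (N∉ ∘ there) k≤ j

insert-injective : ∀ {N} k l σ τ → N ∉ σ → N ∉ τ → k ≤ length σ → l ≤ length τ →
                   insert k N σ ≡ insert l N τ → k ≡ l × σ ≡ τ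
insert-injective zero    zero    σ       τ       _   _   _        _        refl = refl , refl
insert-injective zero    (suc l) σ       (y ∷ τ) _   N∉τ _        _        refl = ⊥-elim (N∉τ (here refl))
insert-injective (suc k) zero    (y ∷ σ) τ       N∉σ _   _        _        refl = ⊥-elim (N∉σ (here refl))
insert-injective (suc k) (suc l) (y ∷ σ) (z ∷ τ) N∉σ N∉τ (s≤s k≤) (s≤s l≤) eq
  with ∷-injective eq
... | refl , eq′ with insert-injective k l σ τ (N∉σ ∘ there) (N∉τ ∘ there) k≤ l≤ eq′
...   | refl , refl = refl , refl

∈-upTo⇒< : ∀ {n y} → y ∈ map suc (upTo n) → y ≤ n
∈-upTo⇒< y∈ with ∈-map⁻ suc y∈
... | j , j∈ , refl = ∈-upTo⁻ j∈

isPerm⇒bounded : ∀ {n σ} → IsPerm n σ → All (_≤ n) σ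
isPerm⇒bounded σ↭ = All.tabulate (λ y∈ → ∈-upTo⇒< (∈-resp-↭ σ↭ y∈))

map-suc-upTo-suc : ∀ n → map suc (upTo (suc n)) ≡ map suc (upTo n) ∷ʳ suc n
map-suc-upTo-suc n = trans (cong (map suc) (sym (upTo-∷ʳ n))) (map-++ suc (upTo n) [ n ])

isPerm-insert : ∀ {n σ} k → IsPerm n σ → IsPerm (suc n) (insert k (suc n) σ)
isPerm-insert {n} {σ} k σ↭ = begin
  take k σ ++ [ suc n ] ++ drop k σ ↭⟨ shift (suc n) (take k σ) (drop k σ) ⟩
  suc n ∷ take k σ ++ drop k σ      ≡⟨ cong (suc n ∷_) (take++drop≡id k σ) ⟩
  suc n ∷ σ                         ↭⟨ prep (suc n) σ↭ ⟩
  suc n ∷ map suc (upTo n)          ↭⟨ ∷↭∷ʳ (suc n) (map suc (upTo n)) ⟩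
  map suc (upTo n) ∷ʳ suc n         ≡⟨ sym (map-suc-upTo-suc n) ⟩
  map suc (upTo (suc n))            ∎
  where open PermutationReasoning

insert-length-++ : ∀ N (l r : List ℕ) → insert (length l) N (l ++ r) ≡ l ++ N ∷ r
insert-length-++ N []      r = refl
insert-length-++ N (y ∷ l) r = cong (y ∷_) (insert-length-++ N l r)

isPerm-delete : ∀ {n π} → IsPerm (suc n) π →
                ∃[ k ] ∃[ σ ] (π ≡ insert k (suc n) σ × k ≤ length σ × IsPerm n σ)
isPerm-delete {n} π↭
  with ∈-∃++ (∈-resp-↭ (↭-sym π↭) (subst (suc n ∈_) (sym (map-suc-upTo-suc n)) (∈-++⁺ʳ _ (here refl))))
... | l , r , refl =
  length l , l ++ r , sym (insert-length-++ (suc n) l r) , length-++-≤ˡ l ,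
  ↭-trans (drop-mid l (map suc (upTo n)) (subst (l ++ [ suc n ] ++ r ↭_) (map-suc-upTo-suc n) π↭))
          (↭-reflexive (++-identityʳ _))

fishburnChildren : ℕ → List ℕ → List (List ℕ)
fishburnChildren N σ = map (λ k → insert k N σ) (trueIndices (sites σ))

fishburns : ℕ → List (List ℕ)
fishburns zero    = [ [] ]
fishburns (suc n) = concatMap (fishburnChildren (suc n)) (fishburns n)

active⇒≤length : ∀ σ {k} → k ∈ trueIndices (sites σ) → k ≤ length σ
active⇒≤length σ {k} k∈ =
  ≤-pred (subst (k <_) (cong suc (length-sitesAfter σ)) (!ᵇ≡true⇒< (sites σ) (∈-trueIndices⁻ (sites σ) k∈)))

insert-fishburn : ∀ {n σ} k → IsPerm n σ → fishburnᵇ σ ≡ true → k ∈ trueIndices (sites σ) →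
                  IsPerm (suc n) (insert k (suc n) σ) × fishburnᵇ (insert k (suc n) σ) ≡ true
insert-fishburn {n} {σ} k σ↭ fσ k∈ =
  isPerm-insert k σ↭ ,
  trans (fishburnᵇ-insert n k σ (isPerm⇒bounded σ↭) (active⇒≤length σ k∈))
        (cong₂ _∧_ fσ (∈-trueIndices⁻ (sites σ) k∈))

∈-fishburns⇒fishburn : ∀ n {π} → π ∈ fishburns n → IsPerm n π × fishburnᵇ π ≡ true
∈-fishburns⇒fishburn zero    (here refl) = ↭-reflexive refl , refl
∈-fishburns⇒fishburn (suc n) π∈ =
  let σ , σ∈ , π∈σ = find (∈-concatMap⁻ (fishburnChildren (suc n)) π∈)
      σ↭ , fσ      = ∈-fishburns⇒fishburn n σ∈
      k , k∈ , π≡  = ∈-map⁻ (λ k → insert k (suc n) σ) π∈σ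
  in subst (λ π → IsPerm (suc n) π × fishburnᵇ π ≡ true) (sym π≡) (insert-fishburn k σ↭ fσ k∈)

fishburn⇒∈-fishburns : ∀ n {π} → IsPerm n π → fishburnᵇ π ≡ true → π ∈ fishburns n
fishburn⇒∈-fishburns zero    π↭ _ with ↭-empty-inv π↭
... | refl = here refl
fishburn⇒∈-fishburns (suc n) π↭ fπ with isPerm-delete π↭
... | k , σ , refl , k≤ , σ↭ =
  ∈-concatMap⁺ (fishburnChildren (suc n))
    (lose (fishburn⇒∈-fishburns n σ↭ (∧-conicalˡ _ _ fσ∧k))
          (∈-map⁺ (λ k → insert k (suc n) σ) (∈-trueIndices⁺ (sites σ) (∧-conicalʳ _ _ fσ∧k))))
  where
  fσ∧k = trans (sym (fishburnᵇ-insert n k σ (isPerm⇒bounded σ↭) k≤)) fπ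

fishburns-unique : ∀ n → Unique (fishburns n)
fishburns-unique zero    = [] ∷ []
fishburns-unique (suc n) =
  concatMap-unique (fishburnChildren (suc n)) (fishburns-unique n)
    (λ {σ} σ∈ → map-unique (λ k∈ l∈ eq → proj₁ (inject σ∈ σ∈ k∈ l∈ eq)) (trueIndices-unique (sites σ)))
    parent
  where
  N∉ : ∀ {σ} → σ ∈ fishburns n → suc n ∉ σ
  N∉ σ∈ N∈ = <-irrefl refl (All.lookup (isPerm⇒bounded (proj₁ (∈-fishburns⇒fishburn n σ∈))) N∈)
  inject : ∀ {σ τ k l} → σ ∈ fishburns n → τ ∈ fishburns n →
           k ∈ trueIndices (sites σ) → l ∈ trueIndices (sites τ) →
           insert k (suc n) σ ≡ insert l (suc n) τ → k ≡ l × σ ≡ τ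
  inject {σ} {τ} {k} {l} σ∈ τ∈ k∈ l∈ =
    insert-injective k l σ τ (N∉ σ∈) (N∉ τ∈) (active⇒≤length σ k∈) (active⇒≤length τ l∈)
  parent : ∀ {σ τ π} → σ ∈ fishburns n → τ ∈ fishburns n →
           π ∈ fishburnChildren (suc n) σ → π ∈ fishburnChildren (suc n) τ → σ ≡ τ
  parent σ∈ τ∈ π∈σ π∈τ with ∈-map⁻ _ π∈σ | ∈-map⁻ _ π∈τ
  ... | k , k∈ , refl | l , l∈ , eq = proj₂ (inject σ∈ τ∈ k∈ l∈ eq)

fishburns-enumerates : ∀ n → Enumerates (λ π → IsPerm n π × Fishburn π) (fishburns n)
fishburns-enumerates n = fishburns-unique n , λ π → mk⇔
  (λ π∈ → let π↭ , fπ = ∈-fishburns⇒fishburn n π∈ in π↭ , Equivalence.from (Fishburn⇔fishburnᵇ π) fπ)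
  (λ (π↭ , fπ) → fishburn⇒∈-fishburns n π↭ (Equivalence.to (Fishburn⇔fishburnᵇ π) fπ))

-- The two generating trees are isomorphic

asc-extend-≤ : ∀ {x a} → x ≢ [] → a ≤ lastLetter x → asc (extend x a) ≡ asc x
asc-extend-≤ {x} x≢[] a≤ rewrite extend-≤ x a≤ = asc-keep x (nonEmpty⇒last x≢[]) a≤

asc-extend-> : ∀ {x a} → x ≢ [] → lastLetter x < a → asc (extend x a) ≡ suc (asc x)
asc-extend-> {x} x≢[] <a rewrite extend-> x <a = asc-raise x (nonEmpty⇒last x≢[]) <a

∷ʳ≢[] : ∀ {A : Set} (v : List A) a → v ∷ʳ a ≢ []
∷ʳ≢[] []      a ()
∷ʳ≢[] (_ ∷ _) a ()

-- x and σ sit at the same place of the two trees; the a-th child of x keeps x exactly when the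
-- a-th active site of σ lies weakly left of the maximum n + 1 (activeToMax).
record Twins (n : ℕ) (x σ : List ℕ) : Set where
  field
    nonEmpty    : x ≢ []
    bounded     : All (_≤ suc n) σ
    activeCount : countTrue (sites σ) ≡ 2 + asc x
    maxPos      : ℕ
    maxAt       : ∀ j → suc n ∈ drop j σ ⇔ j ≤ maxPos
    activeToMax : countTrue (take (suc maxPos) (sites σ)) ≡ lastLetter x

module _ {n x σ a k} (t : Twins n x σ) (nth : NthTrue (sites σ) a k) where
  open Twins t

  private
    N = suc (suc n)

    N∉σ : N ∉ σ
    N∉σ N∈ = <-irrefl refl (All.lookup bounded N∈)

    k≤ : k ≤ length σ
    k≤ = active⇒≤length σ (∈-trueIndices⁺ (sites σ) (proj₁ nth))

    activeTo-k : countTrue (take (suc k) (sites σ)) ≡ suc a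
    activeTo-k = begin
      countTrue (take (suc k) (sites σ))                  ≡⟨ countTrue-take-suc k (sites σ) ⟩
      countTrue (take k (sites σ)) + bit (sites σ !ᵇ k)   ≡⟨ cong₂ _+_ (proj₂ nth) (cong bit (proj₁ nth)) ⟩
      a + 1                                               ≡⟨ +-comm a 1 ⟩
      suc a                                               ∎
      where open ≡-Reasoning

    newSite : activeAfter N (drop k σ) ≡ not (k ≤ᵇ maxPos)
    newSite = cong not (does-⇔ (maxAt k) (suc n ∈? drop k σ) (k ≤? maxPos))

    activeCount-insert : countTrue (sites (insert k N σ)) ≡ countTrue (sites σ) + bit (not (k ≤ᵇ maxPos))
    activeCount-insert = cong suc (trans (countTrue-insert (suc n) k σ bounded k≤) (cong (λ b → _ + bit b) newSite))

    activeCount′ : countTrue (sites (insert k N σ)) ≡ 2 + asc (extend x (suc a))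
    activeCount′ with k ≤? maxPos
    ... | yes k≤p = begin
      countTrue (sites (insert k N σ))               ≡⟨ activeCount-insert ⟩
      countTrue (sites σ) + bit (not (k ≤ᵇ maxPos))  ≡⟨ cong (λ b → countTrue (sites σ) + bit (not b)) (≤ᵇ-true k≤p) ⟩
      countTrue (sites σ) + 0                        ≡⟨ +-identityʳ _ ⟩
      countTrue (sites σ)                            ≡⟨ activeCount ⟩
      2 + asc x                                      ≡⟨ cong (2 +_) (sym (asc-extend-≤ nonEmpty keeps)) ⟩
      2 + asc (extend x (suc a))                     ∎
      where
      open ≡-Reasoning
      keeps : suc a ≤ lastLetter x
      keeps = subst₂ _≤_ activeTo-k activeToMax (countTrue-take-mono (sites σ) (s≤s k≤p))
    ... | no k≰p = begin
      countTrue (sites (insert k N σ))               ≡⟨ activeCount-insert ⟩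
      countTrue (sites σ) + bit (not (k ≤ᵇ maxPos))  ≡⟨ cong (λ b → countTrue (sites σ) + bit (not b)) (≤ᵇ-false (≰⇒> k≰p)) ⟩
      countTrue (sites σ) + 1                        ≡⟨ +-comm _ 1 ⟩
      suc (countTrue (sites σ))                      ≡⟨ cong suc activeCount ⟩
      suc (2 + asc x)                                ≡⟨ cong (2 +_) (sym (asc-extend-> nonEmpty raises)) ⟩
      2 + asc (extend x (suc a))                     ∎
      where
      open ≡-Reasoning
      raises : lastLetter x < suc a
      raises = s≤s (subst₂ _≤_ activeToMax (proj₂ nth) (countTrue-take-mono (sites σ) (≰⇒> k≰p)))

  twins-child : Twins (suc n) (extend x (suc a)) (insert k N σ)
  twins-child = record
    { nonEmpty    = ∷ʳ≢[] _ (suc a)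
    ; bounded     = All.++⁺ (All.take⁺ k bounded′) (≤-refl ∷ All.drop⁺ k bounded′)
    ; activeCount = activeCount′
    ; maxPos      = k
    ; maxAt       = ∈-drop-insert⇔ k σ N∉σ k≤
    ; activeToMax = trans (cong suc (countTrue-take-insert (suc n) k σ bounded k≤))
                          (trans activeTo-k (sym (lastLetter-extend x (suc a))))
    }
    where
    bounded′ = All.map m≤n⇒m≤1+n bounded

twins-children : ∀ {n x σ} → Twins n x σ → Pointwise (Twins (suc n)) (children x) (fishburnChildren (suc (suc n)) σ)
twins-children {n} {x} {σ} t =
  Pointwise.map⁺ (extend x ∘ suc) (λ k → insert k (suc (suc n)) σ)
    (subst (λ as → Pointwise (λ a k → Twins (suc n) (extend x (suc a)) (insert k (suc (suc n)) σ)) as (trueIndices (sites σ)))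
           (cong upTo (Twins.activeCount t))
           (Pointwise.map (twins-child t) (trueIndices-nth (sites σ))))

twins-levels : ∀ n → Pointwise (Twins n) (modAscs (suc n)) (fishburns (suc n))
twins-levels zero    = root ∷ []
  where
  maxAt : ∀ j → 1 ∈ drop j [ 1 ] ⇔ j ≤ 0
  maxAt zero    = mk⇔ (λ _ → z≤n) (λ _ → here refl)
  maxAt (suc zero)    = mk⇔ (λ ()) (λ ())
  maxAt (suc (suc j)) = mk⇔ (λ ()) (λ ())
  root : Twins 0 [ 1 ] [ 1 ]
  root = record { nonEmpty = λ () ; bounded = ≤-refl ∷ [] ; activeCount = refl
                ; maxPos = 0 ; maxAt = maxAt ; activeToMax = refl }
twins-levels (suc n) =
  Pointwise.concat⁺ (Pointwise.map⁺ children (fishburnChildren (suc (suc n))) (Pointwise.map twins-children (twins-levels n)))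

length-modAscs≡length-fishburns : ∀ n → length (modAscs n) ≡ length (fishburns n)
length-modAscs≡length-fishburns zero    = refl
length-modAscs≡length-fishburns (suc n) = Pointwise-length (twins-levels n)

mainTheorem6 : (∀ x → ModAsc x ⇔ CayleyAB x)
    × (∀ n → ∃[ L₁ ] ∃[ L₂ ]
         (Enumerates (λ x → length x ≡ n × CayleyAB x) L₁
          × Enumerates (λ π → IsPerm n π × Fishburn π) L₂
          × length L₁ ≡ length L₂))
mainTheorem6 =
  modAsc⇔cayleyAB ,
  λ n → modAscs n , fishburns n , modAscs-enumerates n , fishburns-enumerates n , length-modAscs≡length-fishburns n
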